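{- Let $\ast_c$ be a choice revision on $K$ such that for all finite $A,B\subseteq\mathcal{L}$: (closure) $\mathrm{Cn}(K\ast_c A)=K\ast_c A$; (relative success) $K\ast_c A=K$ or $A\cap(K\ast_c A)\neq\emptyset$; (regularity) if $A\cap(K\ast_c B)\neq\emptyset$ then $A\cap(K\ast_c A)\neq\emptyset$; (reciprocity) if $(K\ast_c A)\cap B\neq\emptyset$ and $(K\ast_c B)\cap A\neq\emptyset$ then $K\ast_c A=K\ast_c B$. Then for all finite $A,B\subseteq\mathcal{L}$: if $A\equiv B$, then $K\ast_c A=K\ast_c B$.
   Context: $\mathcal{L}$ is a propositional language generated by a set of propositional variables with $\neg,\wedge,\vee,\rightarrow$. $\mathrm{Cn}$ is a consequence operation on $\mathcal{L}$ that is supraclassical, compact and satisfies the deduction property. $\varphi\dashv\vdash\psi$ means $\psi\in\mathrm{Cn}(\{\varphi\})$ and $\varphi\in\mathrm{Cn}(\{\psi\})$. For sets $A,B\subseteq\mathcal{L}$, $A\equiv B$ holds iff for every $\varphi\in A$ there is $\psi\in B$ with $\varphi\dashv\vdash\psi$, and for every $\psi\in B$ there is $\varphi\in A$ with $\varphi\dashv\vdash\psi$. A belief set is $X\subseteq\mathcal{L}$ with $X=\mathrm{Cn}(X)$; $K$ is a fixed consistent belief set. A choice revision on $K$ is a function $\ast_c$ assigning to each finite $A\subseteq\mathcal{L}$ a set $K\ast_c A\subseteq\mathcal{L}$. -}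

module Defs where

open import Data.Bool using (Bool; true; false; not; _∧_; _∨_)
open import Data.List using (List)
open import Data.List.Membership.Propositional using (_∈_)
open import Data.List.Relation.Unary.All using (All)
open import Data.Product using (Σ; ∃; _×_; _,_)
open import Data.Sum using (_⊎_)
open import Relation.Binary.PropositionalEquality using (_≡_)
open import Relation.Nullary using (¬_)

data Form (Var : Set) : Set where
  var  : Var → Form Var
  ¬'_  : Form Var → Form Var
  _∧'_ : Form Var → Form Var → Form Var
  _∨'_ : Form Var → Form Var → Form Var
  _⇒_  : Form Var → Form Var → Form Var

module _ {Var : Set} where

  FSet : Set₁
  FSet = Form Var → Set

  _⊆_ : FSet → FSet → Set
  X ⊆ Y = ∀ φ → X φ → Y φ

  _≐_ : FSet → FSet → Set
  X ≐ Y = (X ⊆ Y) × (Y ⊆ X)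

  _∪_ : FSet → FSet → FSet
  (X ∪ Y) φ = X φ ⊎ Y φ

  ⟦_⟧ : Form Var → FSet
  ⟦ φ ⟧ ψ = ψ ≡ φ

  -- finite sets of formulas are represented by lists
  set : List (Form Var) → FSet
  set A φ = φ ∈ A

  eval : (Var → Bool) → Form Var → Bool
  eval v (var p) = v p
  eval v (¬' φ) = not (eval v φ)
  eval v (φ ∧' ψ) = eval v φ ∧ eval v ψ
  eval v (φ ∨' ψ) = eval v φ ∨ eval v ψ
  eval v (φ ⇒ ψ) = not (eval v φ) ∨ eval v ψ

  Cn₀ : FSet → FSet
  Cn₀ X φ = ∀ (v : Var → Bool) → (∀ ψ → X ψ → eval v ψ ≡ true) → eval v φ ≡ true

  record ConsequenceOp : Set₁ where
    field
      Cn : FSet → FSet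
      inclusion    : ∀ X → X ⊆ Cn X
      monotony     : ∀ X Y → X ⊆ Y → Cn X ⊆ Cn Y
      iteration    : ∀ X → Cn (Cn X) ⊆ Cn X
      supraclassical : ∀ X → Cn₀ X ⊆ Cn X
      compact      : ∀ X φ → Cn X φ →
                     Σ (List (Form Var)) λ A → All X A × Cn (set A) φ
      deduction    : ∀ X φ ψ → Cn (X ∪ ⟦ φ ⟧) ψ → Cn X (φ ⇒ ψ)
      deduction⁻¹  : ∀ X φ ψ → Cn X (φ ⇒ ψ) → Cn (X ∪ ⟦ φ ⟧) ψ

  module _ (C : ConsequenceOp) where
    open ConsequenceOp C

    _⊣⊢_ : Form Var → Form Var → Set
    φ ⊣⊢ ψ = Cn ⟦ φ ⟧ ψ × Cn ⟦ ψ ⟧ φ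

    _≡ₛ_ : List (Form Var) → List (Form Var) → Set
    A ≡ₛ B = (∀ φ → φ ∈ A → ∃ λ ψ → ψ ∈ B × (φ ⊣⊢ ψ))
           × (∀ ψ → ψ ∈ B → ∃ λ φ → φ ∈ A × (φ ⊣⊢ ψ))

    BeliefSet : FSet → Set
    BeliefSet X = Cn X ≐ X

    Consistent : FSet → Set
    Consistent X = ¬ (∀ φ → Cn X φ)

  ChoiceRevision : Set₁
  ChoiceRevision = List (Form Var) → FSet

  Meets : List (Form Var) → FSet → Set
  Meets A X = ∃ λ φ → φ ∈ A × X φ

-- Equivalent inputs transfer membership: a revision outcome that is closed under Cn
-- and meets A also meets every B ≡ A.  So if ∗ A meets A, then by regularity ∗ B meets B,
-- hence A, and reciprocity identifies the two outcomes.  By relative success the only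
-- remaining case is ∗ A ≐ K ≐ ∗ B.
module Submission where

open import Defs
open import Data.List using (List)
open import Data.Product using (_,_; proj₁; swap)
open import Data.Sum using (_⊎_; inj₁; inj₂)
open import Relation.Binary.PropositionalEquality using (sym; subst)

module _ {Var : Set} where

  ≐-sym : {X Y : FSet {Var}} → X ≐ Y → Y ≐ X
  ≐-sym = swap

  ≐-trans : {X Y Z : FSet {Var}} → X ≐ Y → Y ≐ Z → X ≐ Z
  ≐-trans (X⊆Y , Y⊆X) (Y⊆Z , Z⊆Y) =
    (λ φ Xφ → Y⊆Z φ (X⊆Y φ Xφ)) , (λ φ Zφ → Y⊆X φ (Z⊆Y φ Zφ))

  module _ (C : ConsequenceOp {Var}) where
    open ConsequenceOp C

    ≡ₛ-sym : {A B : List (Form Var)} → _≡ₛ_ C A B → _≡ₛ_ C B A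
    ≡ₛ-sym (A→B , B→A) =
      (λ ψ ψ∈B → let φ , φ∈A , φ⊣⊢ψ = B→A ψ ψ∈B in φ , φ∈A , swap φ⊣⊢ψ) ,
      (λ φ φ∈A → let ψ , ψ∈B , φ⊣⊢ψ = A→B φ φ∈A in ψ , ψ∈B , swap φ⊣⊢ψ)

    Meets-≡ₛ : {X : FSet} {A B : List (Form Var)} →
               Cn X ⊆ X → _≡ₛ_ C A B → Meets A X → Meets B X
    Meets-≡ₛ {X} closed (A→B , _) (φ , φ∈A , Xφ) =
      let ψ , ψ∈B , φ⊢ψ , _ = A→B φ φ∈A
          ⟦φ⟧⊆X : ⟦ φ ⟧ ⊆ X
          ⟦φ⟧⊆X χ χ≡φ = subst X (sym χ≡φ) Xφ
      in ψ , ψ∈B , closed ψ (monotony ⟦ φ ⟧ X ⟦φ⟧⊆X ψ φ⊢ψ)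

    module _ (∗ : ChoiceRevision {Var})
             (closure : ∀ A → Cn (∗ A) ≐ ∗ A)
             (regularity : ∀ A B → Meets A (∗ B) → Meets A (∗ A))
             (reciprocity : ∀ A B → Meets B (∗ A) → Meets A (∗ B) → ∗ A ≐ ∗ B)
             where

      ≡ₛ-revision-of-success : ∀ A B → _≡ₛ_ C A B → Meets A (∗ A) → ∗ A ≐ ∗ B
      ≡ₛ-revision-of-success A B A≡B A∩∗A =
        reciprocity A B B∩∗A (Meets-≡ₛ (proj₁ (closure B)) (≡ₛ-sym A≡B) B∩∗B)
        where
        B∩∗A : Meets B (∗ A)
        B∩∗A = Meets-≡ₛ (proj₁ (closure A)) A≡B A∩∗A
        B∩∗B : Meets B (∗ B)
        B∩∗B = regularity B A B∩∗A

mainTheorem2 : {Var : Set} (C : ConsequenceOp {Var}) (K : FSet {Var}) →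
    BeliefSet C K → Consistent C K →
    (∗ : ChoiceRevision {Var}) →
    (∀ A → ConsequenceOp.Cn C (∗ A) ≐ ∗ A) →
    (∀ A → (∗ A ≐ K) ⊎ Meets A (∗ A)) →
    (∀ A B → Meets A (∗ B) → Meets A (∗ A)) →
    (∀ A B → Meets B (∗ A) → Meets A (∗ B) → ∗ A ≐ ∗ B) →
    ∀ A B → _≡ₛ_ C A B → ∗ A ≐ ∗ B
mainTheorem2 C K _ _ ∗ closure relativeSuccess regularity reciprocity A B A≡B
  with relativeSuccess A | relativeSuccess B
... | inj₂ A∩∗A | _ =
  ≡ₛ-revision-of-success C ∗ closure regularity reciprocity A B A≡B A∩∗A
... | inj₁ _ | inj₂ B∩∗B =
  ≐-sym (≡ₛ-revision-of-success C ∗ closure regularity reciprocity B A (≡ₛ-sym C A≡B) B∩∗B)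
... | inj₁ ∗A≐K | inj₁ ∗B≐K = ≐-trans ∗A≐K (≐-sym ∗B≐K)
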